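{- Every 7-saucer is $(2P_3,C_4,C_6)$-free and contains an induced $C_7$.
   Context: All graphs are finite, simple and nonnull. $G$ is $H$-free if no induced subgraph is isomorphic to $H$; $P_k$, $C_k$ are the path and cycle on $k$ vertices; $2P_3$ is two disjoint copies of $P_3$. Cliques may be empty; $X$ complete (anticomplete) to $Y$ means every vertex of $X$ is adjacent (nonadjacent) to every vertex of $Y$. Special partition (indices in $\mathbb{Z}_7$): a partition $(X_0,\dots,X_6;Y_0,\dots,Y_6;Z_0,\dots,Z_6;W)$ of $V(G)$ into cliques such that: (a) $X_0,\dots,X_6$ are nonempty; (b) for all $i$, $X_i$ is complete to $X_{i-1},X_{i+1}$ and anticomplete to $X_{i+2},X_{i+3},X_{i+4},X_{i+5}$; (c) $X_i$ is complete to $Y_i,Y_{i+3},Y_{i+6},Z_i,Z_{i+3},Z_{i+4},Z_{i+5},Z_{i+6},W$ and anticomplete to $Y_{i+1},Y_{i+2},Y_{i+4},Y_{i+5},Z_{i+1},Z_{i+2}$; (d) if $Y_i\neq\emptyset$ then $Y_{i+1},Y_{i+2},Y_{i+5},Y_{i+6},Z_{i+5},Z_{i+6}$ are empty and at most one of $Y_{i+3},Y_{i+4}$ is nonempty; (e) if $Z_i\neq\emptyset$ then $Z_{i+2},Z_{i+5}$ are empty; (f) $Y_i$ is complete to $Y_{i+3},Y_{i+4},Z_i,Z_{i+1},Z_{i+3},Z_{i+4},W$ and anticomplete to $Z_{i+2}$; (g) $Z_i$ is complete to $Z_{i+1},Z_{i+3},Z_{i+4},Z_{i+6},W$. 7-saucer: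 a graph $G$ whose vertex set can be partitioned into $X_0,\dots,X_6,Y_0,\dots,Y_6,Z_0,\dots,Z_6,W,A$ such that $(X_0,\dots,X_6;Y_0,\dots,Y_6;Z_0,\dots,Z_6;W)$ is a special partition of $G\setminus A$; $A$ is anticomplete to $X_0\cup\dots\cup X_6$; for all $i\in\mathbb{Z}_7$, either $A$ is anticomplete to $Y_i$ or $Z_{i+2}=\emptyset$; and either $A=\emptyset$ or $A$ can be partitioned into nonempty pairwise anticomplete cliques $A_1,\dots,A_\ell$, each ordered $A_j=\{a^j_1,\dots,a^j_{r_j}\}$ with $N_G[a^j_{r_j}]\subseteq\dots\subseteq N_G[a^j_1]$. -}

module Defs where

open import Data.Nat using (ℕ; zero; suc; _+_; _≤_; _<_; s≤s; z≤n)
open import Data.Nat.DivMod using (_mod_; _%_)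
open import Data.Fin using (Fin; toℕ)
open import Data.Bool using (Bool; true; false; _∨_)
open import Data.Nat using (_≡ᵇ_)
open import Data.Product using (Σ; _×_; ∃; ∃-syntax)
open import Data.Sum using (_⊎_)
open import Relation.Binary.PropositionalEquality using (_≡_; _≢_)
open import Relation.Nullary using (¬_)

record Graph (n : ℕ) : Set where
  field
    adj     : Fin n → Fin n → Bool
    sym     : ∀ u v → adj u v ≡ adj v u
    irrefl  : ∀ v → adj v v ≡ false
    nonnull : 0 < n
open Graph public

Induced : ∀ {k n} → Graph k → Graph n → Set
Induced {k} {n} H G =
  Σ (Fin k → Fin n) λ f →
    (∀ i j → f i ≡ f j → i ≡ j) ×
    (∀ i j → adj G (f i) (f j) ≡ adj H i j)

Free : ∀ {k n} → Graph k → Graph n → Set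
Free H G = ¬ Induced H G

cycAdj : (k : ℕ) → Fin (suc (suc (suc k))) → Fin (suc (suc (suc k))) → Bool
cycAdj k i j = (toℕ j ≡ᵇ (suc (toℕ i) % suc (suc (suc k))))
             ∨ (toℕ i ≡ᵇ (suc (toℕ j) % suc (suc (suc k))))

C4adj : Fin 4 → Fin 4 → Bool
C6adj : Fin 6 → Fin 6 → Bool
C7adj : Fin 7 → Fin 7 → Bool
C4adj = cycAdj 1
C6adj = cycAdj 3
C7adj = cycAdj 4

twoP3e : ℕ → ℕ → Bool
twoP3e 0 1 = true
twoP3e 1 2 = true
twoP3e 3 4 = true
twoP3e 4 5 = true
twoP3e _ _ = false

twoP3adj : Fin 6 → Fin 6 → Bool
twoP3adj i j = twoP3e (toℕ i) (toℕ j) ∨ twoP3e (toℕ j) (toℕ i)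

open import Data.Bool.Properties using (∨-comm)
import Data.Bool.Properties as BP
open import Data.Fin.Properties using (all?)
open import Relation.Nullary.Decidable using (toWitness)
open import Data.Unit using (tt)

private
  irrefl-by-computation : ∀ {m} (a : Fin m → Fin m → Bool) →
    {w : Relation.Nullary.Decidable.True (all? λ v → a v v BP.≟ false)} →
    ∀ v → a v v ≡ false
  irrefl-by-computation a {w} = toWitness w

C4 : Graph 4
C4 = record { adj = C4adj ; sym = λ u v → ∨-comm (toℕ v ≡ᵇ (suc (toℕ u) % 4)) (toℕ u ≡ᵇ (suc (toℕ v) % 4))
            ; irrefl = irrefl-by-computation C4adj ; nonnull = s≤s z≤n }

C6 : Graph 6
C6 = record { adj = C6adj ; sym = λ u v → ∨-comm (toℕ v ≡ᵇ (suc (toℕ u) % 6)) (toℕ u ≡ᵇ (suc (toℕ v) % 6))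
            ; irrefl = irrefl-by-computation C6adj ; nonnull = s≤s z≤n }

C7 : Graph 7
C7 = record { adj = C7adj ; sym = λ u v → ∨-comm (toℕ v ≡ᵇ (suc (toℕ u) % 7)) (toℕ u ≡ᵇ (suc (toℕ v) % 7))
            ; irrefl = irrefl-by-computation C7adj ; nonnull = s≤s z≤n }

twoP3 : Graph 6
twoP3 = record { adj = twoP3adj ; sym = λ u v → ∨-comm (twoP3e (toℕ u) (toℕ v)) (twoP3e (toℕ v) (toℕ u))
               ; irrefl = irrefl-by-computation twoP3adj ; nonnull = s≤s z≤n }

_⊕_ : Fin 7 → ℕ → Fin 7
i ⊕ k = (toℕ i + k) mod 7

-- Labels of the parts X_i, Y_i, Z_i, W and the cliques A_j of A
-- (A = union of all parts aP j; A_j = vertices labelled aP j)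

data Part : Set where
  xP yP zP : Fin 7 → Part
  wP       : Part
  aP       : ℕ → Part

module SaucerConditions {n : ℕ} (G : Graph n) (lab : Fin n → Part) where

  NonEmpty : Part → Set
  NonEmpty p = ∃[ v ] lab v ≡ p

  Empty : Part → Set
  Empty p = ∀ v → lab v ≢ p

  Complete : Part → Part → Set
  Complete p q = ∀ u v → lab u ≡ p → lab v ≡ q → u ≢ v → adj G u v ≡ true

  Anticomplete : Part → Part → Set
  Anticomplete p q = ∀ u v → lab u ≡ p → lab v ≡ q → adj G u v ≡ false

  InClosedNbhd : Fin n → Fin n → Set
  InClosedNbhd v w = v ≡ w ⊎ adj G v w ≡ true

  -- the parts X,Y,Z,W form a special partition of G \ A
  -- (every part, including each A_j, is a clique: see `cliques` below)
  record SpecialConditions : Set where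
    field
      condA : ∀ i → NonEmpty (xP i)
      condB : ∀ i →
        Complete (xP i) (xP (i ⊕ 6)) × Complete (xP i) (xP (i ⊕ 1)) ×
        Anticomplete (xP i) (xP (i ⊕ 2)) × Anticomplete (xP i) (xP (i ⊕ 3)) ×
        Anticomplete (xP i) (xP (i ⊕ 4)) × Anticomplete (xP i) (xP (i ⊕ 5))
      condC : ∀ i →
        Complete (xP i) (yP i) × Complete (xP i) (yP (i ⊕ 3)) × Complete (xP i) (yP (i ⊕ 6)) ×
        Complete (xP i) (zP i) × Complete (xP i) (zP (i ⊕ 3)) × Complete (xP i) (zP (i ⊕ 4)) ×
        Complete (xP i) (zP (i ⊕ 5)) × Complete (xP i) (zP (i ⊕ 6)) × Complete (xP i) wP ×
        Anticomplete (xP i) (yP (i ⊕ 1)) × Anticomplete (xP i) (yP (i ⊕ 2)) ×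
        Anticomplete (xP i) (yP (i ⊕ 4)) × Anticomplete (xP i) (yP (i ⊕ 5)) ×
        Anticomplete (xP i) (zP (i ⊕ 1)) × Anticomplete (xP i) (zP (i ⊕ 2))
      condD : ∀ i → NonEmpty (yP i) →
        Empty (yP (i ⊕ 1)) × Empty (yP (i ⊕ 2)) × Empty (yP (i ⊕ 5)) × Empty (yP (i ⊕ 6)) ×
        Empty (zP (i ⊕ 5)) × Empty (zP (i ⊕ 6)) ×
        (Empty (yP (i ⊕ 3)) ⊎ Empty (yP (i ⊕ 4)))
      condE : ∀ i → NonEmpty (zP i) → Empty (zP (i ⊕ 2)) × Empty (zP (i ⊕ 5))
      condF : ∀ i →
        Complete (yP i) (yP (i ⊕ 3)) × Complete (yP i) (yP (i ⊕ 4)) ×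
        Complete (yP i) (zP i) × Complete (yP i) (zP (i ⊕ 1)) ×
        Complete (yP i) (zP (i ⊕ 3)) × Complete (yP i) (zP (i ⊕ 4)) ×
        Complete (yP i) wP × Anticomplete (yP i) (zP (i ⊕ 2))
      condG : ∀ i →
        Complete (zP i) (zP (i ⊕ 1)) × Complete (zP i) (zP (i ⊕ 3)) ×
        Complete (zP i) (zP (i ⊕ 4)) × Complete (zP i) (zP (i ⊕ 6)) ×
        Complete (zP i) wP

-- G is a 7-saucer, witnessed by a labelling `lab` of its vertices and,
-- on A, a rank `ord` giving the order a^j_1, a^j_2, ... within each A_j.
record SevenSaucer {n : ℕ} (G : Graph n) : Set where
  field
    lab : Fin n → Part
    ord : Fin n → ℕ
  open SaucerConditions G lab public
  field
    cliques : ∀ p → Complete p p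
    special : SpecialConditions
    AantiX  : ∀ j i → Anticomplete (aP j) (xP i)
    AY      : ∀ i → (∀ j → Anticomplete (aP j) (yP i)) ⊎ Empty (zP (i ⊕ 2))
    Aanti   : ∀ j k → j ≢ k → Anticomplete (aP j) (aP k)
    ordInj  : ∀ j u v → lab u ≡ aP j → lab v ≡ aP j → ord u ≡ ord v → u ≡ v
    ordNest : ∀ j u v → lab u ≡ aP j → lab v ≡ aP j → ord u ≤ ord v →
              ∀ w → InClosedNbhd v w → InClosedNbhd u w

{-# OPTIONS --safe #-}

-- Forget the index j of the cliques A_j, so that every vertex of a 7-saucer carries one of the
-- 23 labels X_i, Y_i, Z_i, W, A. Conditions (a)-(g) then decide, for each ordered pair of labels,
-- whether two distinct vertices so labelled must be adjacent, must be nonadjacent, cannot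
-- coexist, or are unconstrained. The A-vertices add three conditions: adjacent A-vertices lie in
-- one clique A_j, hence share their A-neighbours and have nested closed neighbourhoods, and no
-- A-vertex sees Y_c while Z_(c+2) is nonempty. An induced 2P_3, C_4 or C_6 would yield a
-- labelling of its vertices obeying all of this, and an exhaustive backtracking search shows
-- that there is none. One vertex from each X_i induces C_7.

module Submission where

open import Defs hiding (sym)
open import Data.Bool using (Bool; true; false; T; not; _∨_; _∧_; if_then_else_)
import Data.Bool.Properties as Boolₚ
open import Data.Bool.Properties using (T-≡; T-∨; T-∧)
open import Data.Bool.ListAction using (all)
open import Data.Empty using (⊥; ⊥-elim)
open import Data.Fin using (Fin; toℕ; _≟_)
open import Data.Fin.Patterns
open import Data.Fin.Properties using (all?; toℕ-fromℕ<)
open import Data.List using (List; []; _∷_; _++_; map; upTo; allFin)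
open import Data.List.Membership.Propositional using (_∈_)
open import Data.List.Relation.Unary.Any using (here; there)
open import Data.List.Membership.Propositional.Properties
  using (∈-map⁺; ∈-++⁺ˡ; ∈-++⁺ʳ; ∈-allFin; ∈-upTo⁺; ∈-upTo⁻)
import Data.List.Relation.Unary.All as All
open import Data.List.Relation.Unary.All.Properties using (all⁺; all⁻)
open import Data.Nat using (ℕ; zero; suc; _+_; _∸_; _<_; _≡ᵇ_; z<s; s≤s⁻¹; NonZero)
open import Data.Nat.DivMod using (_mod_; m%n<n; m<n⇒m%n≡m)
import Data.Nat.Properties as ℕₚ
open import Data.Product using (∃-syntax; _×_; _,_; proj₁; proj₂)
open import Data.Sum using (inj₁; inj₂)
open import Data.Unit using (tt)
open import Function.Bundles using (module Equivalence)
open Equivalence using (to; from)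
open import Function using (_∘_)
open import Relation.Binary.PropositionalEquality
  using (_≡_; _≢_; refl; sym; trans; cong; subst)
open import Relation.Nullary using (¬_; does; yes; no)
open import Relation.Nullary.Decidable using (toWitness; ¬?; _→-dec_)

infixr 1 _⇒ᵇ_

_⇒ᵇ_ : Bool → Bool → Bool
true  ⇒ᵇ b = b
false ⇒ᵇ _ = true

⇒ᵇ-intro : ∀ {a b} → (T a → T b) → T (a ⇒ᵇ b)
⇒ᵇ-intro {true}  f = f tt
⇒ᵇ-intro {false} _ = tt

⇒ᵇ-elim : ∀ {a b} → T (a ⇒ᵇ b) → T a → T b
⇒ᵇ-elim {true} t _ = t

⇒ᵇ-mono : ∀ {a b c} → (T b → T c) → T (a ⇒ᵇ b) → T (a ⇒ᵇ c)
⇒ᵇ-mono {true}  b⇒c = b⇒c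
⇒ᵇ-mono {false} _   = _

T-not⁺ : ∀ {b} → ¬ T b → T (not b)
T-not⁺ {false} _  = tt
T-not⁺ {true}  ¬t = ¬t tt

T-not⁻ : ∀ {b} → T (not b) → ¬ T b
T-not⁻ {false} _ ()

allBelow : ℕ → (ℕ → Bool) → Bool
allBelow m p = all p (upTo m)

allBelow⁺ : ∀ {m} p → (∀ {i} → i < m → T (p i)) → T (allBelow m p)
allBelow⁺ p below = all⁻ p (All.tabulate (below ∘ ∈-upTo⁻))

allBelow⁻ : ∀ {m} p → T (allBelow m p) → ∀ {i} → i < m → T (p i)
allBelow⁻ {m} p t i<m = All.lookup (all⁺ p (upTo m) t) (∈-upTo⁺ i<m)

allBelow-mono : ∀ {m p q} → (∀ {i} → i < m → T (p i) → T (q i)) →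
                T (allBelow m p) → T (allBelow m q)
allBelow-mono {p = p} {q} p⇒q t = allBelow⁺ q λ i<m → p⇒q i<m (allBelow⁻ p t i<m)

module Backtracking {L : Set} (labels : List L) (k : ℕ) (h : ℕ → ℕ → Bool)
                    (allowed : L → L → Bool → Bool) (valid : (ℕ → L) → Bool) where

  fits : ℕ → (ℕ → L) → L → Bool
  fits m ls l = allBelow m λ i → allowed (ls i) l (h i m)

  extend : ℕ → (ℕ → L) → L → ℕ → L
  extend m ls l i = if i ≡ᵇ m then l else ls i

  -- refutes m ls r: no labelling that agrees with ls below m and labels the vertices
  -- m, ..., m + r - 1 from labels is allowed on every pair and valid.
  refutes : ℕ → (ℕ → L) → ℕ → Bool
  refutes m ls zero    = not (valid ls)
  refutes m ls (suc r) = all (λ l → fits m ls l ⇒ᵇ refutes (suc m) (extend m ls l) r) labels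

  module _ (valid-local : ∀ {f g} → (∀ {i} → i < k → f i ≡ g i) → T (valid f) → T (valid g))
           (ls : ℕ → L) (ls-listed : ∀ i → ls i ∈ labels)
           (ls-allowed : ∀ {i j} → i < j → j < k → T (allowed (ls i) (ls j) (h i j)))
           (ls-valid : T (valid ls)) where

    refutes-sound : ∀ r {m} pre → m + r ≡ k → (∀ {i} → i < m → pre i ≡ ls i) →
                    ¬ T (refutes m pre r)
    refutes-sound zero {m} pre m+0≡k pre≈ls t =
      T-not⁻ t (valid-local (λ i<k → sym (pre≈ls (subst (_ <_) (sym m≡k) i<k))) ls-valid)
      where
      m≡k : m ≡ k
      m≡k = trans (sym (ℕₚ.+-identityʳ m)) m+0≡k
    refutes-sound (suc r) {m} pre m+1+r≡k pre≈ls t =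
      refutes-sound r (extend m pre (ls m)) (trans (sym (ℕₚ.+-suc m r)) m+1+r≡k) extension≈ls
        (⇒ᵇ-elim (All.lookup (all⁺ _ labels t) (ls-listed m)) ls-fits)
      where
      m<k : m < k
      m<k = subst (m <_) m+1+r≡k (ℕₚ.m<m+n m z<s)

      ls-fits : T (fits m pre (ls m))
      ls-fits = allBelow⁺ _ λ i<m →
        subst (λ l → T (allowed l (ls m) _)) (sym (pre≈ls i<m)) (ls-allowed i<m m<k)

      extension≈ls : ∀ {i} → i < suc m → extend m pre (ls m) i ≡ ls i
      extension≈ls {i} i<1+m with i ≡ᵇ m in i≡ᵇm
      ... | true  = cong ls (sym (ℕₚ.≡ᵇ⇒≡ i m (subst T (sym i≡ᵇm) tt)))
      ... | false = pre≈ls (ℕₚ.≤∧≢⇒< (s≤s⁻¹ i<1+m) (subst T i≡ᵇm ∘ ℕₚ.≡⇒≡ᵇ i m))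

    search-sound : ∀ pre → ¬ T (refutes 0 pre k)
    search-sound pre = refutes-sound k pre refl (λ ())

data Label : Set where
  X Y Z : Fin 7 → Label
  W A   : Label

label : Part → Label
label (xP i) = X i
label (yP i) = Y i
label (zP i) = Z i
label wP     = W
label (aP _) = A

labels : List Label
labels = map X (allFin 7) ++ map Y (allFin 7) ++ map Z (allFin 7) ++ W ∷ A ∷ []

∈-labels : ∀ l → l ∈ labels
∈-labels (X i) = ∈-++⁺ˡ (∈-map⁺ X (∈-allFin i))
∈-labels (Y i) = ∈-++⁺ʳ (map X (allFin 7)) (∈-++⁺ˡ (∈-map⁺ Y (∈-allFin i)))
∈-labels (Z i) = ∈-++⁺ʳ (map X (allFin 7)) (∈-++⁺ʳ (map Y (allFin 7))
                   (∈-++⁺ˡ (∈-map⁺ Z (∈-allFin i))))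
∈-labels W     = ∈-++⁺ʳ (map X (allFin 7)) (∈-++⁺ʳ (map Y (allFin 7))
                   (∈-++⁺ʳ (map Z (allFin 7)) (here refl)))
∈-labels A     = ∈-++⁺ʳ (map X (allFin 7)) (∈-++⁺ʳ (map Y (allFin 7))
                   (∈-++⁺ʳ (map Z (allFin 7)) (there (here refl))))

_⊖_ : Fin 7 → Fin 7 → Fin 7
j ⊖ i = (toℕ j + 7 ∸ toℕ i) mod 7

⊕-identityʳ : ∀ i → i ⊕ 0 ≡ i
⊕-identityʳ = toWitness {a? = all? λ i → i ⊕ 0 ≟ i} tt

⊕-⊖ : ∀ i j → i ⊕ toℕ (j ⊖ i) ≡ j
⊕-⊖ = toWitness {a? = all? λ i → all? λ j → i ⊕ toℕ (j ⊖ i) ≟ j} tt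

data Constraint : Set where
  adjacent nonadjacent incompatible unconstrained : Constraint

permits : Constraint → Bool → Bool
permits adjacent      b = b
permits nonadjacent   b = not b
permits incompatible  _ = false
permits unconstrained _ = true

adjacentIf : Bool → Constraint
adjacentIf true  = adjacent
adjacentIf false = nonadjacent

permits-adjacentIf : ∀ {b c} → T (permits (adjacentIf b) c) → c ≡ b
permits-adjacentIf {true}  {true}  _ = refl
permits-adjacentIf {false} {false} _ = refl

xxAdj xyAdj xzAdj : Fin 7 → Bool
xxAdj 0F = true
xxAdj 1F = true
xxAdj 6F = true
xxAdj _  = false
xyAdj 0F = true
xyAdj 3F = true
xyAdj 6F = true
xyAdj _  = false
xzAdj 1F = false
xzAdj 2F = false
xzAdj _  = true

yy yz zz : Fin 7 → Constraint
yy 0F = adjacent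
yy 3F = adjacent
yy 4F = adjacent
yy _  = incompatible
yz 2F = nonadjacent
yz 5F = incompatible
yz 6F = incompatible
yz _  = adjacent
zz 2F = incompatible
zz 5F = incompatible
zz _  = adjacent

xxAdj-C7 : ∀ i j → i ≢ j → xxAdj (j ⊖ i) ≡ adj C7 i j
xxAdj-C7 =
  toWitness {a? = all? λ i → all? λ j → ¬? (i ≟ j) →-dec xxAdj (j ⊖ i) Boolₚ.≟ adj C7 i j} tt

-- The tables are indexed by the offset of the second Z_7-index from the first: xyAdj d says
-- whether X_i is complete (true) or anticomplete (false) to Y_(i+d).
rel : Label → Label → Constraint
rel (X i) (X j) = adjacentIf (xxAdj (j ⊖ i))
rel (X i) (Y j) = adjacentIf (xyAdj (j ⊖ i))
rel (X i) (Z j) = adjacentIf (xzAdj (j ⊖ i))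
rel (Y i) (X j) = adjacentIf (xyAdj (i ⊖ j))
rel (Y i) (Y j) = yy (j ⊖ i)
rel (Y i) (Z j) = yz (j ⊖ i)
rel (Z i) (X j) = adjacentIf (xzAdj (i ⊖ j))
rel (Z i) (Y j) = yz (i ⊖ j)
rel (Z i) (Z j) = zz (j ⊖ i)
rel (X _) A     = nonadjacent
rel A     (X _) = nonadjacent
rel (X _) W     = adjacent
rel (Y _) W     = adjacent
rel (Z _) W     = adjacent
rel W     (X _) = adjacent
rel W     (Y _) = adjacent
rel W     (Z _) = adjacent
rel W     W     = adjacent
rel _     _     = unconstrained

isA : Label → Bool
isA A = true
isA _ = false

YwithZ+2 : Label → Label → Bool
YwithZ+2 (Y c) (Z d) = does (d ≟ c ⊕ 2)
YwithZ+2 _     _     = false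

module AConditions (k : ℕ) (h : ℕ → ℕ → Bool) where

  closed : ℕ → ℕ → Bool
  closed i m = (i ≡ᵇ m) ∨ h i m

  nbhd⊆ : ℕ → ℕ → Bool
  nbhd⊆ i j = allBelow k λ m → closed i m ⇒ᵇ closed j m

  -- For an A-vertex i with neighbour j. If j is an A-vertex too, then i and j lie in one clique
  -- A_l (distinct ones are anticomplete), so N[i] and N[j] are nested and N[i] contains every
  -- A-neighbour of j.
  conditionsAt : ℕ → ℕ → ℕ → Label → Label → Bool
  conditionsAt i j m b c =
        (isA b ⇒ᵇ nbhd⊆ i j ∨ nbhd⊆ j i)
      ∧ (isA b ⇒ᵇ isA c ⇒ᵇ h j m ⇒ᵇ closed i m)
      ∧ not (YwithZ+2 b c)

  edgeConditions : (ℕ → Label) → ℕ → ℕ → Bool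
  edgeConditions ls i j = h i j ⇒ᵇ allBelow k λ m → conditionsAt i j m (ls j) (ls m)

  valid : (ℕ → Label) → Bool
  valid ls = allBelow k λ i → isA (ls i) ⇒ᵇ allBelow k (edgeConditions ls i)

  valid-local : ∀ {f g} → (∀ {i} → i < k → f i ≡ g i) → T (valid f) → T (valid g)
  valid-local f≈g = allBelow-mono λ i<k →
    subst (λ a → T (isA a ⇒ᵇ _)) (f≈g i<k) ∘
    ⇒ᵇ-mono (allBelow-mono λ j<k → ⇒ᵇ-mono (allBelow-mono λ m<k →
      relabel (f≈g j<k) (f≈g m<k)))
    where
    relabel : ∀ {i j m b b′ c c′} → b ≡ b′ → c ≡ c′ →
              T (conditionsAt i j m b c) → T (conditionsAt i j m b′ c′)
    relabel refl refl t = t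

-- Pattern vertices are indexed by ℕ; only indices below suc k are ever used.
patternAdj : ∀ {k} → Graph (suc k) → ℕ → ℕ → Bool
patternAdj {k} H i j = adj H (i mod suc k) (j mod suc k)

module PatternSearch {k} (H : Graph (suc k)) =
  Backtracking labels (suc k) (patternAdj H) (λ a b → permits (rel a b))
               (AConditions.valid (suc k) (patternAdj H))

unlabellable : ∀ {k} → Graph (suc k) → Bool
unlabellable {k} H = PatternSearch.refutes H 0 (λ _ → W) (suc k)

-- Stated with _≡_ rather than T: checking refl evaluates the search much faster than reducing
-- T (unlabellable H) to ⊤.
twoP3-unlabellable : unlabellable twoP3 ≡ true
twoP3-unlabellable = refl

C4-unlabellable : unlabellable C4 ≡ true
C4-unlabellable = refl

C6-unlabellable : unlabellable C6 ≡ true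
C6-unlabellable = refl

record Copy {n} (G : Graph n) (k : ℕ) (h : ℕ → ℕ → Bool) : Set where
  field
    vertex    : ℕ → Fin n
    injective : ∀ {i j} → i < k → j < k → vertex i ≡ vertex j → i ≡ j
    adjacency : ∀ i j → adj G (vertex i) (vertex j) ≡ h i j

toℕ-mod : ∀ {i m} .{{_ : NonZero m}} → i < m → toℕ (i mod m) ≡ i
toℕ-mod {i} {m} i<m = trans (toℕ-fromℕ< (m%n<n i m)) (m<n⇒m%n≡m i<m)

induced⇒copy : ∀ {k n} {H : Graph (suc k)} {G : Graph n} →
               Induced H G → Copy G (suc k) (patternAdj H)
induced⇒copy {k} (f , f-injective , f-adjacency) = record
  { vertex    = λ i → f (i mod suc k)
  ; injective = λ i<k j<k fi≡fj →
      trans (sym (toℕ-mod i<k)) (trans (cong toℕ (f-injective _ _ fi≡fj)) (toℕ-mod j<k))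
  ; adjacency = λ i j → f-adjacency (i mod suc k) (j mod suc k)
  }

module SaucerLabelling {n} {G : Graph n} (S : SevenSaucer G) where
  open SevenSaucer S
  open SpecialConditions special

  record Respects (p q : Part) (c : Constraint) : Set where
    constructor respecting
    field
      permitted : ∀ u v → lab u ≡ p → lab v ≡ q → u ≢ v → T (permits c (adj G u v))
  open Respects

  complete⇒respects : ∀ {p q} → Complete p q → Respects p q adjacent
  complete⇒respects c = respecting λ u v eu ev u≢v → subst T (sym (c u v eu ev u≢v)) tt

  anticomplete⇒respects : ∀ {p q} → Anticomplete p q → Respects p q nonadjacent
  anticomplete⇒respects a = respecting λ u v eu ev _ → subst (T ∘ not) (sym (a u v eu ev)) tt

  excluded⇒respects : ∀ {p q c} → (NonEmpty p → Empty q) → Respects p q c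
  excluded⇒respects p⇒¬q = respecting λ u v eu ev _ → ⊥-elim (p⇒¬q (u , eu) v ev)

  unconstrained-respects : ∀ {p q} → Respects p q unconstrained
  unconstrained-respects = respecting λ _ _ _ _ _ → tt

  respects-flip : ∀ {p q c} → Respects q p c → Respects p q c
  respects-flip {c = c} r = respecting λ u v eu ev u≢v →
    subst (T ∘ permits c) (Graph.sym G v u) (permitted r v u ev eu (u≢v ∘ sym))

  at-offset-0 : ∀ {p} (Q : Fin 7 → Part) {i c} → Respects p (Q i) c → Respects p (Q (i ⊕ 0)) c
  at-offset-0 Q {i} = subst (λ j → Respects _ (Q j) _) (sym (⊕-identityʳ i))

  clique-respects : ∀ (P : Fin 7 → Part) i → Respects (P i) (P (i ⊕ 0)) adjacent
  clique-respects P i = at-offset-0 P (complete⇒respects (cliques (P i)))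

  XX-respects : ∀ i d → Respects (xP i) (xP (i ⊕ toℕ d)) (adjacentIf (xxAdj d))
  XX-respects i d with condB i
  ... | x6 , x1 , x2 , x3 , x4 , x5 = offset d
    where
    offset : ∀ d → Respects (xP i) (xP (i ⊕ toℕ d)) (adjacentIf (xxAdj d))
    offset 0F = clique-respects xP i
    offset 1F = complete⇒respects x1
    offset 2F = anticomplete⇒respects x2
    offset 3F = anticomplete⇒respects x3
    offset 4F = anticomplete⇒respects x4
    offset 5F = anticomplete⇒respects x5
    offset 6F = complete⇒respects x6

  XY-respects : ∀ i d → Respects (xP i) (yP (i ⊕ toℕ d)) (adjacentIf (xyAdj d))
  XY-respects i d with condC i
  ... | y0 , y3 , y6 , _ , _ , _ , _ , _ , _ , y1 , y2 , y4 , y5 , _ = offset d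
    where
    offset : ∀ d → Respects (xP i) (yP (i ⊕ toℕ d)) (adjacentIf (xyAdj d))
    offset 0F = at-offset-0 yP (complete⇒respects y0)
    offset 1F = anticomplete⇒respects y1
    offset 2F = anticomplete⇒respects y2
    offset 3F = complete⇒respects y3
    offset 4F = anticomplete⇒respects y4
    offset 5F = anticomplete⇒respects y5
    offset 6F = complete⇒respects y6

  XZ-respects : ∀ i d → Respects (xP i) (zP (i ⊕ toℕ d)) (adjacentIf (xzAdj d))
  XZ-respects i d with condC i
  ... | _ , _ , _ , z0 , z3 , z4 , z5 , z6 , _ , _ , _ , _ , _ , z1 , z2 = offset d
    where
    offset : ∀ d → Respects (xP i) (zP (i ⊕ toℕ d)) (adjacentIf (xzAdj d))
    offset 0F = at-offset-0 zP (complete⇒respects z0)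
    offset 1F = anticomplete⇒respects z1
    offset 2F = anticomplete⇒respects z2
    offset 3F = complete⇒respects z3
    offset 4F = complete⇒respects z4
    offset 5F = complete⇒respects z5
    offset 6F = complete⇒respects z6

  YY-respects : ∀ i d → Respects (yP i) (yP (i ⊕ toℕ d)) (yy d)
  YY-respects i d with condF i
  ... | y3 , y4 , _ = offset d
    where
    offset : ∀ d → Respects (yP i) (yP (i ⊕ toℕ d)) (yy d)
    offset 0F = clique-respects yP i
    offset 1F = excluded⇒respects λ y → let (¬y1 , _) = condD i y in ¬y1
    offset 2F = excluded⇒respects λ y → let (_ , ¬y2 , _) = condD i y in ¬y2
    offset 3F = complete⇒respects y3
    offset 4F = complete⇒respects y4
    offset 5F = excluded⇒respects λ y → let (_ , _ , ¬y5 , _) = condD i y in ¬y5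
    offset 6F = excluded⇒respects λ y → let (_ , _ , _ , ¬y6 , _) = condD i y in ¬y6

  YZ-respects : ∀ i d → Respects (yP i) (zP (i ⊕ toℕ d)) (yz d)
  YZ-respects i d with condF i
  ... | _ , _ , z0 , z1 , z3 , z4 , _ , z2 = offset d
    where
    offset : ∀ d → Respects (yP i) (zP (i ⊕ toℕ d)) (yz d)
    offset 0F = at-offset-0 zP (complete⇒respects z0)
    offset 1F = complete⇒respects z1
    offset 2F = anticomplete⇒respects z2
    offset 3F = complete⇒respects z3
    offset 4F = complete⇒respects z4
    offset 5F = excluded⇒respects λ y → let (_ , _ , _ , _ , ¬z5 , _) = condD i y in ¬z5
    offset 6F = excluded⇒respects λ y → let (_ , _ , _ , _ , _ , ¬z6 , _) = condD i y in ¬z6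

  ZZ-respects : ∀ i d → Respects (zP i) (zP (i ⊕ toℕ d)) (zz d)
  ZZ-respects i d with condG i
  ... | z1 , z3 , z4 , z6 , _ = offset d
    where
    offset : ∀ d → Respects (zP i) (zP (i ⊕ toℕ d)) (zz d)
    offset 0F = clique-respects zP i
    offset 1F = complete⇒respects z1
    offset 2F = excluded⇒respects λ z → let (¬z2 , _) = condE i z in ¬z2
    offset 3F = complete⇒respects z3
    offset 4F = complete⇒respects z4
    offset 5F = excluded⇒respects λ z → let (_ , ¬z5) = condE i z in ¬z5
    offset 6F = complete⇒respects z6

  X-complete-W : ∀ i → Complete (xP i) wP
  X-complete-W i with condC i
  ... | _ , _ , _ , _ , _ , _ , _ , _ , w , _ = w

  Y-complete-W : ∀ i → Complete (yP i) wP
  Y-complete-W i with condF i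
  ... | _ , _ , _ , _ , _ , _ , w , _ = w

  Z-complete-W : ∀ i → Complete (zP i) wP
  Z-complete-W i with condG i
  ... | _ , _ , _ , _ , w = w

  respects-by-offset : ∀ (P Q : Fin 7 → Part) {t : Fin 7 → Constraint} i j →
          (∀ d → Respects (P i) (Q (i ⊕ toℕ d)) (t d)) → Respects (P i) (Q j) (t (j ⊖ i))
  respects-by-offset P Q {t} i j r =
    subst (λ j′ → Respects (P i) (Q j′) (t (j ⊖ i))) (⊕-⊖ i j) (r (j ⊖ i))

  respects : ∀ p q → Respects p q (rel (label p) (label q))
  respects (xP i) (xP j) = respects-by-offset xP xP i j (XX-respects i)
  respects (xP i) (yP j) = respects-by-offset xP yP i j (XY-respects i)
  respects (xP i) (zP j) = respects-by-offset xP zP i j (XZ-respects i)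
  respects (xP i) wP     = complete⇒respects (X-complete-W i)
  respects (xP i) (aP a) = respects-flip (anticomplete⇒respects (AantiX a i))
  respects (yP i) (xP j) = respects-flip (respects-by-offset xP yP j i (XY-respects j))
  respects (yP i) (yP j) = respects-by-offset yP yP i j (YY-respects i)
  respects (yP i) (zP j) = respects-by-offset yP zP i j (YZ-respects i)
  respects (yP i) wP     = complete⇒respects (Y-complete-W i)
  respects (yP _) (aP _) = unconstrained-respects
  respects (zP i) (xP j) = respects-flip (respects-by-offset xP zP j i (XZ-respects j))
  respects (zP i) (yP j) = respects-flip (respects-by-offset yP zP j i (YZ-respects j))
  respects (zP i) (zP j) = respects-by-offset zP zP i j (ZZ-respects i)
  respects (zP i) wP     = complete⇒respects (Z-complete-W i)
  respects (zP _) (aP _) = unconstrained-respects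
  respects wP     (xP j) = respects-flip (complete⇒respects (X-complete-W j))
  respects wP     (yP j) = respects-flip (complete⇒respects (Y-complete-W j))
  respects wP     (zP j) = respects-flip (complete⇒respects (Z-complete-W j))
  respects wP     wP     = complete⇒respects (cliques wP)
  respects wP     (aP _) = unconstrained-respects
  respects (aP a) (xP i) = anticomplete⇒respects (AantiX a i)
  respects (aP _) (yP _) = unconstrained-respects
  respects (aP _) (zP _) = unconstrained-respects
  respects (aP _) wP     = unconstrained-respects
  respects (aP _) (aP _) = unconstrained-respects

  C7-induced : Induced C7 G
  C7-induced = x , x-injective , x-adjacency
    where
    x : Fin 7 → Fin n
    x i = proj₁ (condA i)

    x∈X : ∀ i → lab (x i) ≡ xP i
    x∈X i = proj₂ (condA i)

    x-injective : ∀ i j → x i ≡ x j → i ≡ j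
    x-injective i j xi≡xj with trans (sym (x∈X i)) (trans (cong lab xi≡xj) (x∈X j))
    ... | refl = refl

    x-adjacency : ∀ i j → adj G (x i) (x j) ≡ adj C7 i j
    x-adjacency i j with i ≟ j
    ... | yes refl = trans (irrefl G (x i)) (sym (irrefl C7 i))
    ... | no i≢j   = trans (permits-adjacentIf x-respects) (xxAdj-C7 i j i≢j)
      where
      x-respects : T (permits (rel (X i) (X j)) (adj G (x i) (x j)))
      x-respects = permitted (respects (xP i) (xP j)) _ _ (x∈X i) (x∈X j) (i≢j ∘ x-injective i j)

  isA-label : ∀ p → T (isA (label p)) → ∃[ a ] p ≡ aP a
  isA-label (aP a) _ = a , refl

  YwithZ+2-label : ∀ p q → T (YwithZ+2 (label p) (label q)) →
                   ∃[ c ] p ≡ yP c × q ≡ zP (c ⊕ 2)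
  YwithZ+2-label (yP c) (zP d) t with d ≟ c ⊕ 2
  ... | yes refl = c , refl , refl
  YwithZ+2-label (yP _) (xP _) ()
  YwithZ+2-label (yP _) (yP _) ()
  YwithZ+2-label (yP _) wP     ()
  YwithZ+2-label (yP _) (aP _) ()

  adjacent-A-same-clique : ∀ {u v a b} → lab u ≡ aP a → lab v ≡ aP b →
                           adj G u v ≡ true → a ≡ b
  adjacent-A-same-clique {u} {v} {a} {b} eu ev uv with a ℕₚ.≟ b
  ... | yes a≡b = a≡b
  ... | no a≢b with () ← trans (sym uv) (Aanti a b a≢b u v eu ev)

  same-clique-closed : ∀ {u v p} → lab u ≡ p → lab v ≡ p → InClosedNbhd u v
  same-clique-closed {u} {v} {p} eu ev with u ≟ v
  ... | yes u≡v = inj₁ u≡v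
  ... | no u≢v  = inj₂ (cliques p u v eu ev u≢v)

  module _ {k h} (copy : Copy G k h) where
    open Copy copy
    open AConditions k h

    labelling : ℕ → Label
    labelling i = label (lab (vertex i))

    labelling-allowed : ∀ {i j} → i < j → j < k →
                        T (permits (rel (labelling i) (labelling j)) (h i j))
    labelling-allowed {i} {j} i<j j<k =
      subst (T ∘ permits (rel (labelling i) (labelling j))) (adjacency i j)
        (permitted (respects (lab (vertex i)) (lab (vertex j))) _ _ refl refl
          (ℕₚ.<⇒≢ i<j ∘ injective (ℕₚ.<-trans i<j j<k) j<k))

    edge : ∀ {i j} → T (h i j) → adj G (vertex i) (vertex j) ≡ true
    edge {i} {j} t = trans (adjacency i j) (to T-≡ t)

    closed⇒InClosedNbhd : ∀ i m → T (closed i m) → InClosedNbhd (vertex i) (vertex m)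
    closed⇒InClosedNbhd i m t with to T-∨ t
    ... | inj₁ i≡ᵇm = inj₁ (cong vertex (ℕₚ.≡ᵇ⇒≡ i m i≡ᵇm))
    ... | inj₂ i~m  = inj₂ (edge i~m)

    InClosedNbhd⇒closed : ∀ {i m} → i < k → m < k →
                          InClosedNbhd (vertex i) (vertex m) → T (closed i m)
    InClosedNbhd⇒closed {i} {m} i<k m<k (inj₁ vi≡vm) =
      from T-∨ (inj₁ (ℕₚ.≡⇒≡ᵇ i m (injective i<k m<k vi≡vm)))
    InClosedNbhd⇒closed {i} {m} _ _ (inj₂ vi~vm) =
      from T-∨ (inj₂ (from T-≡ (trans (sym (adjacency i m)) vi~vm)))

    nbhd⊆-intro : ∀ {i j} → j < k →
      (∀ w → InClosedNbhd (vertex i) w → InClosedNbhd (vertex j) w) → T (nbhd⊆ i j)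
    nbhd⊆-intro {i} {j} j<k N[i]⊆N[j] = allBelow⁺ _ λ m<k → ⇒ᵇ-intro λ t →
      InClosedNbhd⇒closed j<k m<k (N[i]⊆N[j] _ (closed⇒InClosedNbhd i _ t))

    A-nested : ∀ {i j a} → i < k → j < k → lab (vertex i) ≡ aP a → T (h i j) →
               T (isA (labelling j) ⇒ᵇ nbhd⊆ i j ∨ nbhd⊆ j i)
    A-nested {i} {j} {a} i<k j<k i∈A i~j = ⇒ᵇ-intro λ jA → nested (isA-label _ jA)
      where
      nested : ∃[ b ] lab (vertex j) ≡ aP b → T (nbhd⊆ i j ∨ nbhd⊆ j i)
      nested (b , j∈A) with adjacent-A-same-clique i∈A j∈A (edge i~j)
      ... | refl with ℕₚ.≤-total (ord (vertex i)) (ord (vertex j))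
      ... | inj₁ i≤j = from T-∨ (inj₂ (nbhd⊆-intro i<k (ordNest a _ _ i∈A j∈A i≤j)))
      ... | inj₂ j≤i = from T-∨ (inj₁ (nbhd⊆-intro j<k (ordNest a _ _ j∈A i∈A j≤i)))

    A-transitive : ∀ {i j m a} → i < k → m < k → lab (vertex i) ≡ aP a → T (h i j) →
                   T (isA (labelling j) ⇒ᵇ isA (labelling m) ⇒ᵇ h j m ⇒ᵇ closed i m)
    A-transitive {i} {j} {m} i<k m<k i∈A i~j =
      ⇒ᵇ-intro λ jA → ⇒ᵇ-intro λ mA → ⇒ᵇ-intro (via (isA-label _ jA) (isA-label _ mA))
      where
      via : ∃[ b ] lab (vertex j) ≡ aP b → ∃[ c ] lab (vertex m) ≡ aP c →
            T (h j m) → T (closed i m)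
      via (b , j∈A) (c , m∈A) j~m
        with adjacent-A-same-clique i∈A j∈A (edge i~j) | adjacent-A-same-clique j∈A m∈A (edge j~m)
      ... | refl | refl = InClosedNbhd⇒closed i<k m<k (same-clique-closed i∈A m∈A)

    A-unblocked : ∀ {i j m a} → lab (vertex i) ≡ aP a → T (h i j) →
                  T (not (YwithZ+2 (labelling j) (labelling m)))
    A-unblocked {i} {j} {m} {a} i∈A i~j = T-not⁺ λ t → blocked (YwithZ+2-label _ _ t)
      where
      blocked : ∃[ c ] lab (vertex j) ≡ yP c × lab (vertex m) ≡ zP (c ⊕ 2) → ⊥
      blocked (c , j∈Y , m∈Z) with AY c
      ... | inj₁ A-Y-anticomplete
          with () ← trans (sym (edge i~j)) (A-Y-anticomplete a _ _ i∈A j∈Y)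
      ... | inj₂ Z-empty = Z-empty _ m∈Z

    labelling-valid : T (valid labelling)
    labelling-valid = allBelow⁺ (λ i → isA (labelling i) ⇒ᵇ allBelow k (edgeConditions labelling i))
      λ {i} i<k → ⇒ᵇ-intro λ iA → let a , i∈A = isA-label (lab (vertex i)) iA in
      allBelow⁺ (edgeConditions labelling i) λ {j} j<k → ⇒ᵇ-intro λ i~j →
      allBelow⁺ (λ m → conditionsAt i j m (labelling j) (labelling m)) λ {m} m<k →
        from T-∧ (A-nested i<k j<k i∈A i~j ,
          from T-∧ (A-transitive i<k m<k i∈A i~j , A-unblocked i∈A i~j))

  unlabellable⇒free : ∀ {k} (H : Graph (suc k)) → unlabellable H ≡ true → Free H G
  unlabellable⇒free {k} H refuted H↪G =
    PatternSearch.search-sound H (AConditions.valid-local (suc k) (patternAdj H))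
      (labelling copy) (∈-labels ∘ labelling copy) (labelling-allowed copy) (labelling-valid copy)
      (λ _ → W) (from T-≡ refuted)
    where
    copy : Copy G (suc k) (patternAdj H)
    copy = induced⇒copy {H = H} H↪G

proposition3p4 : ∀ {n : ℕ} (G : Graph n) → SevenSaucer G →
    Free twoP3 G × Free C4 G × Free C6 G × Induced C7 G
proposition3p4 G S =
    unlabellable⇒free twoP3 twoP3-unlabellable
  , unlabellable⇒free C4 C4-unlabellable
  , unlabellable⇒free C6 C6-unlabellable
  , C7-induced
  where open SaucerLabelling S
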